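{- Let $m,n\geq3$. Then $P(S,m\times n)=\bigcup_{i,j\in\{1,2\}}P_{i,j}(S,m\times n)$, and the four sets $P_{i,j}(S,m\times n)$, $i,j\in\{1,2\}$, are non-empty and pairwise disjoint.
   Context: Let $\mathcal{A}=\{\mathtt{A},\dots,\mathtt{P}\}$, $\mathcal{B}=\{\mathtt{0},\mathtt{1},\mathtt{2},\mathtt{3}\}$. The substitution $\mu$ maps each letter to a $2\times2$ block over $\mathcal{A}$ (written (first row / second row)): $\mathtt{A}\mapsto(\mathtt{AF}/\mathtt{GC})$, $\mathtt{B}\mapsto(\mathtt{AF}/\mathtt{HD})$, $\mathtt{C}\mapsto(\mathtt{BE}/\mathtt{GC})$, $\mathtt{D}\mapsto(\mathtt{BE}/\mathtt{HD})$, $\mathtt{E}\mapsto(\mathtt{AN}/\mathtt{GK})$, $\mathtt{F}\mapsto(\mathtt{AN}/\mathtt{HL})$, $\mathtt{G}\mapsto(\mathtt{BM}/\mathtt{GK})$, $\mathtt{H}\mapsto(\mathtt{BM}/\mathtt{HL})$, $\mathtt{I}\mapsto(\mathtt{IF}/\mathtt{OC})$, $\mathtt{J}\mapsto(\mathtt{IF}/\mathtt{PD})$, $\mathtt{K}\mapsto(\mathtt{JE}/\mathtt{OC})$, $\mathtt{L}\mapsto(\mathtt{JE}/\mathtt{PD})$, $\mathtt{M}\mapsto(\mathtt{IN}/\mathtt{OK})$, $\mathtt{N}\mapsto(\mathtt{IN}/\mathtt{PL})$, $\mathtt{O}\mapsto(\mathtt{JM}/\mathtt{OK})$, $\mathtt{P}\mapsto(\mathtt{JM}/\mathtt{PL})$.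 The map $\phi$ from $\mathcal{A}$ to $2\times2$ blocks over $\mathcal{B}$: $\mathtt{A}\mapsto(01/00)$, $\mathtt{B}\mapsto(01/11)$, $\mathtt{C}\mapsto(10/00)$, $\mathtt{D}\mapsto(10/11)$, $\mathtt{E}\mapsto(03/02)$, $\mathtt{F}\mapsto(03/13)$, $\mathtt{G}\mapsto(12/02)$, $\mathtt{H}\mapsto(12/13)$, $\mathtt{I}\mapsto(21/20)$, $\mathtt{J}\mapsto(21/31)$, $\mathtt{K}\mapsto(30/20)$, $\mathtt{L}\mapsto(30/31)$, $\mathtt{M}\mapsto(23/22)$, $\mathtt{N}\mapsto(23/33)$, $\mathtt{O}\mapsto(32/22)$, $\mathtt{P}\mapsto(32/33)$. For an $m\times n$ matrix $X$ over $\mathcal{A}$, $\mu(X)$ and $\phi(X)$ are the $2m\times2n$ matrices obtained by replacing each entry by its block; $\mu^0=\mathrm{id}$, $\mu^k=\mu^{k-1}\circ\mu$; $T_k:=\mu^k(\mathtt{N})$. For a matrix $X$, $X[r,c,m\times n]$ is its $m\times n$ contiguous submatrix with upper-left corner at row $r$, column $c$, and $P(X,m\times n)$ is the set of all its $m\times n$ contiguous submatrices. Put $P(T,m\times n):=\bigcup_{k\ge0}P(T_k,m\times n)$ and $P(S,m\times n):=\bigcup_{k\ge0}P(\phi(T_k),m\times n)$. For $i,j\in\{1,2\}$, $P_{i,j}(S,m\times n):=\{\phi(x)[i,j,m\times n]: x\in P(T,m\times n)\}$. -}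

module Defs where

open import Data.Nat using (ℕ; zero; suc; _+_; _*_; _^_; _≤_; _<?_)
open import Data.Nat.DivMod using (_/_; _%_)
open import Data.Fin using (Fin; toℕ; fromℕ<)
open import Data.Product using (Σ; ∃; _×_; _,_)
open import Relation.Binary.PropositionalEquality using (_≡_)
open import Relation.Nullary using (yes; no)

data 𝒜 : Set where
  A B C D E F G H I J K L M N O P : 𝒜

data ℬ : Set where
  b0 b1 b2 b3 : ℬ

data Block (X : Set) : Set where
  blk : (tl tr bl br : X) → Block X

sel : {X : Set} → ℕ → ℕ → Block X → X
sel zero    zero    (blk tl tr bl br) = tl
sel zero    (suc _) (blk tl tr bl br) = tr
sel (suc _) zero    (blk tl tr bl br) = bl
sel (suc _) (suc _) (blk tl tr bl br) = br

μ : 𝒜 → Block 𝒜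
μ A = blk A F G C
μ B = blk A F H D
μ C = blk B E G C
μ D = blk B E H D
μ E = blk A N G K
μ F = blk A N H L
μ G = blk B M G K
μ H = blk B M H L
μ I = blk I F O C
μ J = blk I F P D
μ K = blk J E O C
μ L = blk J E P D
μ M = blk I N O K
μ N = blk I N P L
μ O = blk J M O K
μ P = blk J M P L

φ : 𝒜 → Block ℬ
φ A = blk b0 b1 b0 b0
φ B = blk b0 b1 b1 b1
φ C = blk b1 b0 b0 b0
φ D = blk b1 b0 b1 b1
φ E = blk b0 b3 b0 b2
φ F = blk b0 b3 b1 b3
φ G = blk b1 b2 b0 b2
φ H = blk b1 b2 b1 b3
φ I = blk b2 b1 b2 b0
φ J = blk b2 b1 b3 b1
φ K = blk b3 b0 b2 b0
φ L = blk b3 b0 b3 b1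
φ M = blk b2 b3 b2 b2
φ N = blk b2 b3 b3 b3
φ O = blk b3 b2 b2 b2
φ P = blk b3 b2 b3 b3

-- A matrix is given by its entry function (0-indexed row, column);
-- its dimensions are tracked separately.
Mat : Set → Set
Mat X = ℕ → ℕ → X

blockMap : {X Y : Set} → (X → Block Y) → Mat X → Mat Y
blockMap f Z = λ r c → sel (r % 2) (c % 2) (f (Z (r / 2) (c / 2)))

μMat : Mat 𝒜 → Mat 𝒜
μMat = blockMap μ

φMat : Mat 𝒜 → Mat ℬ
φMat = blockMap φ

μPow : ℕ → Mat 𝒜 → Mat 𝒜
μPow zero    X = X
μPow (suc k) X = μPow k (μMat X)

T : ℕ → Mat 𝒜
T k = μPow k (λ _ _ → N)

Occurs : {Z : Set} {m n : ℕ} → (rows cols : ℕ) → Mat Z → (Fin m → Fin n → Z) → Set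
Occurs {m = m} {n} rows cols X y =
  Σ ℕ λ r → Σ ℕ λ c → (r + m ≤ rows) × (c + n ≤ cols) ×
    (∀ a b → X (r + toℕ a) (c + toℕ b) ≡ y a b)

PT : (m n : ℕ) → (Fin m → Fin n → 𝒜) → Set
PT m n x = Σ ℕ λ k → Occurs (2 ^ k) (2 ^ k) (T k) x

PS : (m n : ℕ) → (Fin m → Fin n → ℬ) → Set
PS m n y = Σ ℕ λ k → Occurs (2 * 2 ^ k) (2 * 2 ^ k) (φMat (T k)) y

-- view an m×n Fin-indexed matrix as an entry function (the default
-- value outside the m×n range is never consulted below)
toMat : {Z : Set} {m n : ℕ} → Z → (Fin m → Fin n → Z) → Mat Z
toMat d x = λ r c → go d x r c
  where
  go : {Z : Set} {m n : ℕ} → Z → (Fin m → Fin n → Z) → ℕ → ℕ → Z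
  go {m = m} {n} d x r c with r <? m | c <? n
  ... | yes p | yes q = x (fromℕ< p) (fromℕ< q)
  ... | _     | _     = d

-- y ∈ P_{i+1,j+1}(S, m×n)  for i j : Fin 2  (0-indexed offsets)
Pij : (m n : ℕ) → Fin 2 → Fin 2 → (Fin m → Fin n → ℬ) → Set
Pij m n i j y = Σ (Fin m → Fin n → 𝒜) λ x → PT m n x ×
  (∀ a b → φMat (toMat A x) (toℕ i + toℕ a) (toℕ j + toℕ b) ≡ y a b)

{-# OPTIONS --safe #-}
module Submission where

-- The block maps μ and φ commute with translations by even amounts. Hence an occurrence of x in
-- T k at (r, c) yields one of φ(x) in φ(T k) at (2r, 2c); conversely, an m×n submatrix of φ(T k)
-- at (r, c) is the submatrix of φ(x) at offset (r mod 2, c mod 2), where x is read off a copy of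
-- T k inside T (3 + k) that leaves room for all of x.
-- Disjointness is a finite check: every 2×2 window of every T k belongs to an explicit list of
-- 83 windows that is closed under μ, and for each of these windows w the 3×3 patch of φ(w) at
-- offset (i, j) determines (i, j). As m, n ≥ 3, the top-left 3×3 corner of an element of
-- P_{i,j}(S) is such a patch.

open import Defs
open import Data.Empty using (⊥)
open import Data.Fin as Fin using (Fin; toℕ; fromℕ<; inject≤)
open import Data.Fin.Properties as Fin using (toℕ<n; toℕ≤pred[n]; toℕ-fromℕ<; toℕ-inject≤)
open import Data.List using (List; []; _∷_; allFin; cartesianProduct; filter; head)
open import Data.List.Membership.Propositional using (_∈_)
import Data.List.Membership.DecPropositional as DecMembership
open import Data.List.Relation.Unary.All as All using (All)
open import Data.List.Relation.Unary.Any using (here; any?)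
open import Data.Maybe using (fromMaybe)
open import Data.Nat as ℕ using (ℕ; zero; suc; _+_; _*_; _^_; _≤_; _<_; NonZero; >-nonZero⁻¹; s≤s; z<s; s<s)
open import Data.Nat.DivMod
open import Data.Nat.Divisibility using (m∣m*n)
open import Data.Nat.Properties
open import Data.Nat.Tactic.RingSolver using (solve-∀)
open import Data.Product using (Σ; _×_; _,_)
import Data.Product.Properties as Product
open import Data.Vec using (Vec; tabulate)
import Data.Vec.Properties as Vec
open import Function using (_∘_; id; mk↣)
open import Relation.Binary.Definitions using (DecidableEquality)
open import Relation.Binary.PropositionalEquality
  using (_≡_; _≢_; refl; sym; trans; cong; cong₂; subst; _≗_; module ≡-Reasoning)
open import Relation.Nullary using (yes; no; contradiction)
open import Relation.Nullary.Decidable using (via-injection; from-yes; map′; _×-dec_)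

private variable
  X Y : Set

≡-dec-via-code : (code : X → ℕ) (decode : ℕ → X) → decode ∘ code ≗ id → DecidableEquality X
≡-dec-via-code code decode retract = via-injection (mk↣ injective) ℕ._≟_
  where
  injective : ∀ {x y} → code x ≡ code y → x ≡ y
  injective {x} {y} e = trans (sym (retract x)) (trans (cong decode e) (retract y))

code𝒜 : 𝒜 → ℕ
code𝒜 A = 0
code𝒜 B = 1
code𝒜 C = 2
code𝒜 D = 3
code𝒜 E = 4
code𝒜 F = 5
code𝒜 G = 6
code𝒜 H = 7
code𝒜 I = 8
code𝒜 J = 9
code𝒜 K = 10
code𝒜 L = 11
code𝒜 M = 12
code𝒜 N = 13
code𝒜 O = 14
code𝒜 P = 15

decode𝒜 : ℕ → 𝒜
decode𝒜 0 = A
decode𝒜 1 = B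
decode𝒜 2 = C
decode𝒜 3 = D
decode𝒜 4 = E
decode𝒜 5 = F
decode𝒜 6 = G
decode𝒜 7 = H
decode𝒜 8 = I
decode𝒜 9 = J
decode𝒜 10 = K
decode𝒜 11 = L
decode𝒜 12 = M
decode𝒜 13 = N
decode𝒜 14 = O
decode𝒜 _ = P

_≟𝒜_ : DecidableEquality 𝒜
_≟𝒜_ = ≡-dec-via-code code𝒜 decode𝒜 λ
  { A → refl ; B → refl ; C → refl ; D → refl ; E → refl ; F → refl ; G → refl ; H → refl
  ; I → refl ; J → refl ; K → refl ; L → refl ; M → refl ; N → refl ; O → refl ; P → refl }

codeℬ : ℬ → ℕ
codeℬ b0 = 0
codeℬ b1 = 1
codeℬ b2 = 2
codeℬ b3 = 3

decodeℬ : ℕ → ℬ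
decodeℬ 0 = b0
decodeℬ 1 = b1
decodeℬ 2 = b2
decodeℬ _ = b3

_≟ℬ_ : DecidableEquality ℬ
_≟ℬ_ = ≡-dec-via-code codeℬ decodeℬ λ { b0 → refl ; b1 → refl ; b2 → refl ; b3 → refl }

blk-cong : ∀ {a b c d a′ b′ c′ d′ : X} → a ≡ a′ → b ≡ b′ → c ≡ c′ → d ≡ d′ → blk a b c d ≡ blk a′ b′ c′ d′
blk-cong refl refl refl refl = refl

≟-Block : DecidableEquality X → DecidableEquality (Block X)
≟-Block _≟_ (blk a b c d) (blk a′ b′ c′ d′) =
  map′ (λ { (p , q , r , s) → blk-cong p q r s }) (λ { refl → refl , refl , refl , refl })
       (a ≟ a′ ×-dec b ≟ b′ ×-dec c ≟ c′ ×-dec d ≟ d′)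

shift : ℕ → ℕ → Mat X → Mat X
shift r c Z u v = Z (r + u) (c + v)

window : Mat X → Block X
window Z = blk (Z 0 0) (Z 0 1) (Z 1 0) (Z 1 1)

blockMat : Block X → Mat X
blockMat w u v = sel u v w

window-blockMat : (w : Block X) → window (blockMat w) ≡ w
window-blockMat (blk _ _ _ _) = refl

sel-window : ∀ (Z : Mat X) {s t} → s < 2 → t < 2 → sel s t (window Z) ≡ Z s t
sel-window Z {zero}  {zero}  _ _ = refl
sel-window Z {zero}  {suc zero} _ _ = refl
sel-window Z {suc zero} {zero}  _ _ = refl
sel-window Z {suc zero} {suc zero} _ _ = refl
sel-window Z {suc (suc _)} (s<s (s<s ())) _
sel-window Z {_} {suc (suc _)} _ (s<s (s<s ()))

window-cong : ∀ {Z Z′ : Mat X} → (∀ {s t} → s < 2 → t < 2 → Z s t ≡ Z′ s t) → window Z ≡ window Z′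
window-cong eq = blk-cong (eq 0<2 0<2) (eq 0<2 1<2) (eq 1<2 0<2) (eq 1<2 1<2)
  where
  0<2 : 0 < 2
  0<2 = z<s
  1<2 : 1 < 2
  1<2 = s<s z<s

blockMap-cong : ∀ (f : X → Block Y) {Z Z′ : Mat X} {u v} →
  Z (u / 2) (v / 2) ≡ Z′ (u / 2) (v / 2) → blockMap f Z u v ≡ blockMap f Z′ u v
blockMap-cong f {u = u} {v} = cong (sel (u % 2) (v % 2) ∘ f)

blockMap-window : ∀ (f : X → Block Y) {Z Z′ : Mat X} {u v} →
  window Z ≡ window Z′ → u < 4 → v < 4 → blockMap f Z u v ≡ blockMap f Z′ u v
blockMap-window f {Z} {Z′} {u} {v} eq u<4 v<4 =
  blockMap-cong f {Z} {Z′} {u} {v}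
    (agree (m<n*o⇒m/o<n {n = 2} {o = 2} u<4) (m<n*o⇒m/o<n {n = 2} {o = 2} v<4))
  where
  agree : ∀ {s t} → s < 2 → t < 2 → Z s t ≡ Z′ s t
  agree {s} {t} s<2 t<2 =
    trans (sym (sel-window Z s<2 t<2)) (trans (cong (sel s t) eq) (sel-window Z′ s<2 t<2))

[2m+n]%2≡n%2 : ∀ m n → (2 * m + n) % 2 ≡ n % 2
[2m+n]%2≡n%2 m n =
  trans (cong (_% 2) (trans (+-comm (2 * m) n) (cong (n +_) (*-comm 2 m)))) ([m+kn]%n≡m%n n m 2)

[2m+n]/2≡m+n/2 : ∀ m n → (2 * m + n) / 2 ≡ m + n / 2
[2m+n]/2≡m+n/2 m n =
  trans (+-distrib-/-∣ˡ n (m∣m*n m)) (cong (_+ n / 2) (trans (/-congˡ (*-comm 2 m)) (m*n/n≡m m 2)))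

blockMap-shift : ∀ (f : X → Block Y) (Z : Mat X) r c u v →
  blockMap f (shift r c Z) u v ≡ blockMap f Z (2 * r + u) (2 * c + v)
blockMap-shift f Z r c u v = sym (begin
  sel ((2 * r + u) % 2) ((2 * c + v) % 2) (f (Z ((2 * r + u) / 2) ((2 * c + v) / 2)))
    ≡⟨ cong₂ (λ p q → sel p q (f (Z ((2 * r + u) / 2) ((2 * c + v) / 2)))) ([2m+n]%2≡n%2 r u) ([2m+n]%2≡n%2 c v) ⟩
  sel (u % 2) (v % 2) (f (Z ((2 * r + u) / 2) ((2 * c + v) / 2)))
    ≡⟨ cong₂ (λ s t → sel (u % 2) (v % 2) (f (Z s t))) ([2m+n]/2≡m+n/2 r u) ([2m+n]/2≡m+n/2 c v) ⟩
  sel (u % 2) (v % 2) (f (Z (r + u / 2) (c + v / 2))) ∎)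
  where open ≡-Reasoning

blockMap-agree : ∀ (f : X → Block Y) {Z Z′ : Mat X} {r c u v} →
  Z (u / 2) (v / 2) ≡ Z′ (r + u / 2) (c + v / 2) → blockMap f Z u v ≡ blockMap f Z′ (2 * r + u) (2 * c + v)
blockMap-agree f {Z} {Z′} {r} {c} {u} {v} eq =
  trans (blockMap-cong f {Z} {shift r c Z′} {u} {v} eq) (blockMap-shift f Z′ r c u v)

split-parity : ∀ r s → r + s ≡ 2 * (r / 2) + (toℕ (r mod 2) + s)
split-parity r s = begin
  r + s                                  ≡⟨ cong (_+ s) (DivMod.property (r divMod 2)) ⟩
  toℕ (r mod 2) + r / 2 * 2 + s          ≡⟨ cong (_+ s) (+-comm (toℕ (r mod 2)) _) ⟩
  r / 2 * 2 + toℕ (r mod 2) + s          ≡⟨ +-assoc (r / 2 * 2) _ s ⟩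
  r / 2 * 2 + (toℕ (r mod 2) + s)        ≡⟨ cong (_+ (toℕ (r mod 2) + s)) (*-comm (r / 2) 2) ⟩
  2 * (r / 2) + (toℕ (r mod 2) + s)      ∎
  where open ≡-Reasoning

μPow-suc : ∀ k (Z : Mat 𝒜) u v → μPow (suc k) Z u v ≡ μMat (μPow k Z) u v
μPow-suc zero    Z u v = refl
μPow-suc (suc k) Z u v = μPow-suc k (μMat Z) u v

μPow-block : ∀ k (Z : Mat 𝒜) p q {u v} → u < 2 ^ k → v < 2 ^ k →
  μPow k Z (2 ^ k * p + u) (2 ^ k * q + v) ≡ μPow k (λ _ _ → Z p q) u v
μPow-block zero    Z p q z<s z<s =
  cong₂ Z (trans (+-identityʳ _) (*-identityˡ p)) (trans (+-identityʳ _) (*-identityˡ q))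
μPow-block (suc k) Z p q {u} {v} u< v< = begin
  μPow (suc k) Z (2 ^ suc k * p + u) (2 ^ suc k * q + v)
    ≡⟨ μPow-suc k Z _ _ ⟩
  μMat (μPow k Z) (2 ^ suc k * p + u) (2 ^ suc k * q + v)
    ≡⟨ cong₂ (μMat (μPow k Z)) (cong (_+ u) (*-assoc 2 (2 ^ k) p)) (cong (_+ v) (*-assoc 2 (2 ^ k) q)) ⟩
  μMat (μPow k Z) (2 * (2 ^ k * p) + u) (2 * (2 ^ k * q) + v)
    ≡⟨ blockMap-agree μ {μPow k Zₚ} {μPow k Z} {2 ^ k * p} {2 ^ k * q} {u} {v}
         (sym (μPow-block k Z p q (half< u<) (half< v<))) ⟨
  μMat (μPow k Zₚ) u v
    ≡⟨ μPow-suc k Zₚ u v ⟨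
  μPow (suc k) Zₚ u v ∎
  where
  open ≡-Reasoning
  Zₚ : Mat 𝒜
  Zₚ _ _ = Z p q
  half< : ∀ {w} → w < 2 ^ suc k → w / 2 < 2 ^ k
  half< {w} w< = m<n*o⇒m/o<n {w} {2 ^ k} {2} (subst (w <_) (*-comm 2 (2 ^ k)) w<)

-- T 3 0 3 = N, so the block of T (3 + k) at block position (0, 3) is a copy of T k.
T-embedding : ∀ k {s t} → s < 2 ^ k → t < 2 ^ k → T (3 + k) s (2 ^ k * 3 + t) ≡ T k s t
T-embedding k {s} s< t< =
  trans (cong (λ s′ → T (3 + k) s′ _) (sym (cong (_+ s) (*-zeroʳ (2 ^ k)))))
        (μPow-block k (T 3) 0 3 s< t<)

-- The 2×2 windows of the T k

open DecMembership (≟-Block _≟𝒜_) using (_∈?_)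

-- The closure of blk N N N N under childWindow, computed in advance.
goodWindows : List (Block 𝒜)
goodWindows =
  blk N N N N ∷ blk I N P L ∷ blk N I L P ∷ blk P L I N ∷ blk L P N I ∷ blk I F O C ∷ blk F I C P ∷
  blk O C J M ∷ blk C P M J ∷ blk N I L O ∷ blk P L J E ∷ blk L O E J ∷ blk J M P L ∷ blk M J L P ∷
  blk P L I F ∷ blk L P F I ∷ blk J E P D ∷ blk E J D P ∷ blk P D I N ∷ blk D P N I ∷ blk F A C H ∷
  blk C H M B ∷ blk A N H L ∷ blk H L B E ∷ blk J M O K ∷ blk M B K G ∷ blk O K I F ∷ blk K G F I ∷
  blk B E G C ∷ blk E J C P ∷ blk G C I N ∷ blk C P N I ∷ blk L P F A ∷ blk E J D O ∷ blk P D A N ∷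
  blk D O N I ∷ blk I F P D ∷ blk F I D O ∷ blk P D J M ∷ blk D O M J ∷ blk I N O K ∷ blk N I K P ∷
  blk O K J E ∷ blk K P E J ∷ blk F A D G ∷ blk D G M B ∷ blk A N G K ∷ blk G K B E ∷ blk M B L H ∷
  blk L H F I ∷ blk B E H D ∷ blk H D I N ∷ blk N A L G ∷ blk L G E B ∷ blk E B C H ∷ blk C H N A ∷
  blk A F G C ∷ blk G C B M ∷ blk B M H L ∷ blk H L A F ∷ blk N A K H ∷ blk K H E B ∷ blk M J K O ∷
  blk K O F A ∷ blk J E O C ∷ blk E B C G ∷ blk O C A N ∷ blk C G N I ∷ blk A F H D ∷ blk H D B M ∷
  blk B M G K ∷ blk G K I F ∷ blk D P N A ∷ blk P L A F ∷ blk E B D G ∷ blk D G N A ∷ blk G K A F ∷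
  blk E B D H ∷ blk D H N I ∷ blk H L I F ∷ blk E J C O ∷ blk C O N A ∷ blk O K A F ∷ []

childWindow : Fin 2 → Fin 2 → Block 𝒜 → Block 𝒜
childWindow p q w = window (shift (toℕ p) (toℕ q) (μMat (blockMat w)))

goodWindows-closed : All (λ w → ∀ p q → childWindow p q w ∈ goodWindows) goodWindows
goodWindows-closed = from-yes
  (All.all? (λ w → Fin.all? λ p → Fin.all? λ q → childWindow p q w ∈? goodWindows) goodWindows)

window-shift-μMat : ∀ (Z : Mat 𝒜) r c →
  window (shift r c (μMat Z)) ≡ childWindow (r mod 2) (c mod 2) (window (shift (r / 2) (c / 2) Z))
window-shift-μMat Z r c = window-cong {Z = shift r c (μMat Z)} {shift p q (μMat (blockMat (window Z′)))} entry
  where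
  p = toℕ (r mod 2)
  q = toℕ (c mod 2)
  Z′ = shift (r / 2) (c / 2) Z
  entry : ∀ {s t} → s < 2 → t < 2 → μMat Z (r + s) (c + t) ≡ μMat (blockMat (window Z′)) (p + s) (q + t)
  entry {s} {t} s<2 t<2 = begin
    μMat Z (r + s) (c + t)
      ≡⟨ cong₂ (μMat Z) (split-parity r s) (split-parity c t) ⟩
    μMat Z (2 * (r / 2) + (p + s)) (2 * (c / 2) + (q + t))
      ≡⟨ blockMap-shift μ Z (r / 2) (c / 2) (p + s) (q + t) ⟨
    μMat Z′ (p + s) (q + t)
      ≡⟨ blockMap-window μ {Z′} {blockMat (window Z′)} (sym (window-blockMat (window Z′)))
           (+-mono-< (toℕ<n (r mod 2)) s<2) (+-mono-< (toℕ<n (c mod 2)) t<2) ⟩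
    μMat (blockMat (window Z′)) (p + s) (q + t) ∎
    where open ≡-Reasoning

GoodWindows : Mat 𝒜 → Set
GoodWindows Z = ∀ r c → window (shift r c Z) ∈ goodWindows

μMat-goodWindows : ∀ Z → GoodWindows Z → GoodWindows (μMat Z)
μMat-goodWindows Z good r c = subst (_∈ goodWindows) (sym (window-shift-μMat Z r c))
  (All.lookup goodWindows-closed (good (r / 2) (c / 2)) (r mod 2) (c mod 2))

μPow-goodWindows : ∀ k Z → GoodWindows Z → GoodWindows (μPow k Z)
μPow-goodWindows zero    Z good = good
μPow-goodWindows (suc k) Z good = μPow-goodWindows k (μMat Z) (μMat-goodWindows Z good)

T-goodWindows : ∀ k → GoodWindows (T k)
T-goodWindows k = μPow-goodWindows k (λ _ _ → N) (λ _ _ → here refl)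

-- Recognising the offset of a 3×3 patch

Patch : Set
Patch = Vec (Vec ℬ 3) 3

patch : Fin 2 × Fin 2 → Mat 𝒜 → Patch
patch (i , j) Z = tabulate λ a → tabulate λ b → φMat Z (toℕ i + toℕ a) (toℕ j + toℕ b)

_≟Patch_ : DecidableEquality Patch
_≟Patch_ = Vec.≡-dec (Vec.≡-dec _≟ℬ_)

recognise : Patch → Fin 2 × Fin 2
recognise y = fromMaybe (Fin.zero , Fin.zero)
  (head (filter (λ o → any? (λ w → patch o (blockMat w) ≟Patch y) goodWindows) (cartesianProduct (allFin 2) (allFin 2))))

recognise-correct : All (λ w → ∀ i j → recognise (patch (i , j) (blockMat w)) ≡ (i , j)) goodWindows
recognise-correct = from-yes (All.all? (λ w → Fin.all? λ i → Fin.all? λ j →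
  Product.≡-dec Fin._≟_ Fin._≟_ (recognise (patch (i , j) (blockMat w))) (i , j)) goodWindows)

patch-window : ∀ o {Z Z′ : Mat 𝒜} → window Z ≡ window Z′ → patch o Z ≡ patch o Z′
patch-window (i , j) {Z} {Z′} eq = Vec.tabulate-cong λ a → Vec.tabulate-cong λ b →
  blockMap-window φ {Z} {Z′} eq (offset+index< i a) (offset+index< j b)
  where
  offset+index< : (i : Fin 2) (a : Fin 3) → toℕ i + toℕ a < 4
  offset+index< i a = +-mono-≤-< (toℕ≤pred[n] i) (toℕ<n a)

recognise-patch : ∀ {Z} → window Z ∈ goodWindows → ∀ i j → recognise (patch (i , j) Z) ≡ (i , j)
recognise-patch {Z} good i j =
  trans (cong recognise (patch-window (i , j) {Z} {blockMat (window Z)} (sym (window-blockMat (window Z)))))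
        (All.lookup recognise-correct good i j)

-- Occurrences in T k and φ(T k)

toMat-fromℕ< : ∀ {m n} (d : X) (x : Fin m → Fin n → X) {u v} (u<m : u < m) (v<n : v < n) →
  toMat d x u v ≡ x (fromℕ< u<m) (fromℕ< v<n)
toMat-fromℕ< {m = m} {n} d x {u} {v} u<m v<n with u ℕ.<? m | v ℕ.<? n
... | yes _   | yes _   = refl
... | no u≮m  | _       = contradiction u<m u≮m
... | yes _   | no v≮n  = contradiction v<n v≮n

toMat-occurs : ∀ {m n} (d : X) (Z : Mat X) (x : Fin m → Fin n → X) {r c u v} →
  (∀ a b → Z (r + toℕ a) (c + toℕ b) ≡ x a b) → u < m → v < n → toMat d x u v ≡ Z (r + u) (c + v)
toMat-occurs d Z x {r} {c} occ u<m v<n = begin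
  toMat d x _ _                                           ≡⟨ toMat-fromℕ< d x u<m v<n ⟩
  x (fromℕ< u<m) (fromℕ< v<n)                             ≡⟨ occ (fromℕ< u<m) (fromℕ< v<n) ⟨
  Z (r + toℕ (fromℕ< u<m)) (c + toℕ (fromℕ< v<n))         ≡⟨ cong₂ (λ s t → Z (r + s) (c + t)) (toℕ-fromℕ< u<m) (toℕ-fromℕ< v<n) ⟩
  Z (r + _) (c + _)                                       ∎
  where open ≡-Reasoning

PT-goodWindow : ∀ {m n} {x : Fin m → Fin n → 𝒜} → 2 ≤ m → 2 ≤ n → PT m n x → window (toMat A x) ∈ goodWindows
PT-goodWindow {x = x} 2≤m 2≤n (k , r , c , _ , _ , occ) =
  subst (_∈ goodWindows) (sym (window-cong {Z = toMat A x} {shift r c (T k)} entry)) (T-goodWindows k r c)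
  where
  entry : ∀ {s t} → s < 2 → t < 2 → toMat A x s t ≡ T k (r + s) (c + t)
  entry s<2 t<2 = toMat-occurs A (T k) x occ (≤-trans s<2 2≤m) (≤-trans t<2 2≤n)

offset≤ : ∀ {m} .{{_ : NonZero m}} (i : Fin 2) → toℕ i ≤ m
offset≤ {m} i = ≤-trans (toℕ≤pred[n] i) (>-nonZero⁻¹ m)

[offset+index]/2< : ∀ {m} .{{_ : NonZero m}} (i : Fin 2) (a : Fin m) → (toℕ i + toℕ a) / 2 < m
[offset+index]/2< {m} i a =
  ≤-<-trans (/-monoˡ-≤ 2 (≤-trans (+-monoˡ-≤ (toℕ a) (toℕ≤pred[n] i)) (toℕ<n a))) (m/n<m m 2 (s<s z<s))

doubled-room : ∀ {l s e b} → e ≤ l → s + l ≤ b → 2 * s + e + l ≤ 2 * b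
doubled-room {l} {s} {e} {b} e≤l s+l≤b = begin
  2 * s + e + l   ≤⟨ +-monoˡ-≤ l (+-monoʳ-≤ (2 * s) e≤l) ⟩
  2 * s + l + l   ≡⟨ regroup s l ⟩
  2 * (s + l)     ≤⟨ *-monoʳ-≤ 2 s+l≤b ⟩
  2 * b           ∎
  where
  open ≤-Reasoning
  regroup : ∀ s l → 2 * s + l + l ≡ 2 * (s + l)
  regroup = solve-∀

Pij⇒PS : ∀ {m n} .{{_ : NonZero m}} .{{_ : NonZero n}} i j {y : Fin m → Fin n → ℬ} → Pij m n i j y → PS m n y
Pij⇒PS {m} {n} i j {y} (x , (k , r , c , r+m≤ , c+n≤ , occ) , hy) =
  k , 2 * r + toℕ i , 2 * c + toℕ j ,
  doubled-room (offset≤ {m} i) r+m≤ , doubled-room (offset≤ {n} j) c+n≤ , entry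
  where
  entry : ∀ a b → φMat (T k) (2 * r + toℕ i + toℕ a) (2 * c + toℕ j + toℕ b) ≡ y a b
  entry a b = begin
    φMat (T k) (2 * r + toℕ i + toℕ a) (2 * c + toℕ j + toℕ b)
      ≡⟨ cong₂ (φMat (T k)) (+-assoc (2 * r) _ _) (+-assoc (2 * c) _ _) ⟩
    φMat (T k) (2 * r + (toℕ i + toℕ a)) (2 * c + (toℕ j + toℕ b))
      ≡⟨ blockMap-agree φ {toMat A x} {T k} {r} {c}
           (toMat-occurs A (T k) x occ ([offset+index]/2< i a) ([offset+index]/2< j b)) ⟨
    φMat (toMat A x) (toℕ i + toℕ a) (toℕ j + toℕ b)
      ≡⟨ hy a b ⟩
    y a b ∎
    where open ≡-Reasoning

halves< : ∀ {l b} s (a : Fin l) → s + l ≤ 2 * b → s / 2 + (toℕ (s mod 2) + toℕ a) / 2 < b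
halves< {l} {b} s a s+l≤ = subst (_< b) (trans (cong (_/ 2) (split-parity s (toℕ a))) ([2m+n]/2≡m+n/2 (s / 2) _))
  (m<n*o⇒m/o<n {n = b} {o = 2} (<-≤-trans (+-monoʳ-< s (toℕ<n a)) (subst (s + l ≤_) (*-comm 2 b) s+l≤)))

PS⇒Pij : ∀ {m n} .{{_ : NonZero m}} .{{_ : NonZero n}} {y : Fin m → Fin n → ℬ} →
  PS m n y → Σ (Fin 2) λ i → Σ (Fin 2) λ j → Pij m n i j y
PS⇒Pij {m} {n} {y} (k , r , c , r+m≤ , c+n≤ , occ) =
  r mod 2 , c mod 2 , x , (3 + k , r / 2 , side * 3 + c / 2 , row-room , column-room , λ _ _ → refl) , entry
  where
  side : ℕ
  side = 2 ^ k
  x : Fin m → Fin n → 𝒜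
  x a b = T (3 + k) (r / 2 + toℕ a) (side * 3 + c / 2 + toℕ b)
  row-room : r / 2 + m ≤ 2 ^ (3 + k)
  row-room = ≤-trans (+-monoˡ-≤ m (m/n≤m r 2)) (≤-trans r+m≤ (^-monoʳ-≤ 2 (s≤s (m≤n+m k 2))))
  column-room : side * 3 + c / 2 + n ≤ 2 ^ (3 + k)
  column-room = begin
    side * 3 + c / 2 + n             ≡⟨ +-assoc (side * 3) (c / 2) n ⟩
    side * 3 + (c / 2 + n)           ≤⟨ +-monoʳ-≤ (side * 3) (≤-trans (+-monoˡ-≤ n (m/n≤m c 2)) c+n≤) ⟩
    side * 3 + 2 * side              ≤⟨ m≤m+n (side * 3 + 2 * side) (side * 3) ⟩
    side * 3 + 2 * side + side * 3   ≡⟨ eight side ⟩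
    2 * (2 * (2 * side))             ∎
    where
    open ≤-Reasoning
    eight : ∀ s → s * 3 + 2 * s + s * 3 ≡ 2 * (2 * (2 * s))
    eight = solve-∀
  entry : ∀ a b → φMat (toMat A x) (toℕ (r mod 2) + toℕ a) (toℕ (c mod 2) + toℕ b) ≡ y a b
  entry a b = begin
    φMat (toMat A x) (toℕ (r mod 2) + toℕ a) (toℕ (c mod 2) + toℕ b)
      ≡⟨ blockMap-agree φ {toMat A x} {T k} {r / 2} {c / 2} agree ⟩
    φMat (T k) (2 * (r / 2) + (toℕ (r mod 2) + toℕ a)) (2 * (c / 2) + (toℕ (c mod 2) + toℕ b))
      ≡⟨ cong₂ (φMat (T k)) (split-parity r (toℕ a)) (split-parity c (toℕ b)) ⟨
    φMat (T k) (r + toℕ a) (c + toℕ b)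
      ≡⟨ occ a b ⟩
    y a b ∎
    where
    open ≡-Reasoning
    u = (toℕ (r mod 2) + toℕ a) / 2
    v = (toℕ (c mod 2) + toℕ b) / 2
    agree : toMat A x u v ≡ T k (r / 2 + u) (c / 2 + v)
    agree = begin
      toMat A x u v
        ≡⟨ toMat-occurs A (T (3 + k)) x (λ _ _ → refl) ([offset+index]/2< (r mod 2) a) ([offset+index]/2< (c mod 2) b) ⟩
      T (3 + k) (r / 2 + u) (side * 3 + c / 2 + v)
        ≡⟨ cong (T (3 + k) (r / 2 + u)) (+-assoc (side * 3) (c / 2) v) ⟩
      T (3 + k) (r / 2 + u) (side * 3 + (c / 2 + v))
        ≡⟨ T-embedding k (halves< r a r+m≤) (halves< c b c+n≤) ⟩
      T k (r / 2 + u) (c / 2 + v) ∎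

n<2^n : ∀ n → n < 2 ^ n
n<2^n zero    = z<s
n<2^n (suc n) = ≤-<-trans (n<2^n n) (^-monoʳ-< 2 (s<s z<s) (n<1+n n))

Pij-nonempty : ∀ m n i j → Σ (Fin m → Fin n → ℬ) λ y → Pij m n i j y
Pij-nonempty m n i j =
  (λ a b → φMat (toMat A x) (toℕ i + toℕ a) (toℕ j + toℕ b)) ,
  x , (m + n , 0 , 0 , m≤2^[m+n] , n≤2^[m+n] , λ _ _ → refl) , λ _ _ → refl
  where
  x : Fin m → Fin n → 𝒜
  x a b = T (m + n) (toℕ a) (toℕ b)
  m≤2^[m+n] : m ≤ 2 ^ (m + n)
  m≤2^[m+n] = ≤-trans (<⇒≤ (n<2^n m)) (^-monoʳ-≤ 2 (m≤m+n m n))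
  n≤2^[m+n] : n ≤ 2 ^ (m + n)
  n≤2^[m+n] = ≤-trans (<⇒≤ (n<2^n n)) (^-monoʳ-≤ 2 (m≤n+m n m))

corner : ∀ {m n} → 3 ≤ m → 3 ≤ n → (Fin m → Fin n → ℬ) → Patch
corner 3≤m 3≤n y = tabulate λ a → tabulate λ b → y (inject≤ a 3≤m) (inject≤ b 3≤n)

Pij-corner : ∀ {m n} (3≤m : 3 ≤ m) (3≤n : 3 ≤ n) i j {y} → Pij m n i j y → recognise (corner 3≤m 3≤n y) ≡ (i , j)
Pij-corner 3≤m 3≤n i j {y} (x , x∈T , hy) = begin
  recognise (corner 3≤m 3≤n y)
    ≡⟨ cong recognise corner≡patch ⟩
  recognise (patch (i , j) (toMat A x))
    ≡⟨ recognise-patch {toMat A x} (PT-goodWindow (≤-trans (n≤1+n 2) 3≤m) (≤-trans (n≤1+n 2) 3≤n) x∈T) i j ⟩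
  (i , j) ∎
  where
  open ≡-Reasoning
  entry : ∀ a b → y (inject≤ a 3≤m) (inject≤ b 3≤n) ≡ φMat (toMat A x) (toℕ i + toℕ a) (toℕ j + toℕ b)
  entry a b = trans (sym (hy _ _))
    (cong₂ (λ s t → φMat (toMat A x) (toℕ i + s) (toℕ j + t)) (toℕ-inject≤ a 3≤m) (toℕ-inject≤ b 3≤n))
  corner≡patch : corner 3≤m 3≤n y ≡ patch (i , j) (toMat A x)
  corner≡patch = Vec.tabulate-cong λ a → Vec.tabulate-cong λ b → entry a b

lemma4 : (m n : ℕ) → 3 ≤ m → 3 ≤ n →
    ((y : Fin m → Fin n → ℬ) →
      (PS m n y → Σ (Fin 2) λ i → Σ (Fin 2) λ j → Pij m n i j y) ×
      ((Σ (Fin 2) λ i → Σ (Fin 2) λ j → Pij m n i j y) → PS m n y))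
    × ((i j : Fin 2) → Σ (Fin m → Fin n → ℬ) λ y → Pij m n i j y)
    × ((i j i′ j′ : Fin 2) → (i , j) ≢ (i′ , j′) →
        (y : Fin m → Fin n → ℬ) → Pij m n i j y → Pij m n i′ j′ y → ⊥)
lemma4 m n 3≤m@(s≤s _) 3≤n@(s≤s _) =
  (λ y → PS⇒Pij , λ { (i , j , y∈Pij) → Pij⇒PS i j y∈Pij }) ,
  Pij-nonempty m n ,
  λ i j i′ j′ ij≢i′j′ y y∈Pij y∈Pi′j′ →
    ij≢i′j′ (trans (sym (Pij-corner 3≤m 3≤n i j y∈Pij)) (Pij-corner 3≤m 3≤n i′ j′ y∈Pi′j′))
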